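{- Let $n\ge1$ and $\alpha\ge2$ be integers. The Euler characteristic of the $\alpha$-colored permutohedron is $$\chi(P_n^\alpha)=\frac{(\alpha-1)^n}{\alpha}\,A_n\!\left(\frac{\alpha}{\alpha-1}\right).$$
   Context: For $\pi\in\mathfrak{S}_n$, $d(\pi)=|\{i\in[n-1]:\pi(i)>\pi(i+1)\}|$ and $A_n(x)=\sum_{\pi\in\mathfrak{S}_n}x^{1+d(\pi)}$. For $m\ge1$, $P_m$ denotes the permutohedron: the convex hull in $\mathbb{R}^m$ of all permutations of $(1,\dots,m)$. Fix a set of $\alpha$ colors and a distinguished color $\beta$. An $\alpha$-colored ordered set partition of $[n]$ is a sequence $(B_1,\dots,B_k)$ of nonempty pairwise disjoint sets with union $[n]$, each block assigned one of the $\alpha$ colors, with last block colored $\beta$; its type is $(|B_1|,\dots,|B_k|)$; it is alternating if consecutive blocks have different colors. $P_n^\alpha$ is the polytopal complex that is the disjoint union, over all alternating $\alpha$-colored ordered set partitions $\tau$ of $[n]$, of a copy of $P_{c_1}\times\cdots\times P_{c_k}$, where $(c_1,\dots,c_k)$ is the type of $\tau$. -}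

module Defs where

open import Data.Nat as ℕ using (ℕ; zero; suc; _∸_; _<ᵇ_)
open import Data.Bool using (Bool; true; false; _∧_; not; if_then_else_)
open import Data.Fin using (Fin; toℕ)
open import Data.Fin.Properties using () renaming (_≟_ to _≟F_)
open import Data.List using (List; []; _∷_; map; concatMap; foldr; length; filter; upTo; allFin; _++_; reverse)
open import Data.Product using (_×_; _,_; proj₁; proj₂)
open import Data.Integer as ℤ using (ℤ)
open import Data.Rational as ℚ using (ℚ)
open import Relation.Nullary.Decidable using (⌊_⌋)
open import Data.Bool.Properties using () renaming (_≟_ to _≟B_)

sumℤ : List ℤ → ℤ
sumℤ = foldr ℤ._+_ (ℤ.+ 0)

sumℚ : List ℚ → ℚ
sumℚ = foldr ℚ._+_ ℚ.0ℚ

powℚ : ℚ → ℕ → ℚ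
powℚ x zero    = ℚ.1ℚ
powℚ x (suc k) = x ℚ.* powℚ x k

range : ℕ → List ℕ
range n = map suc (upTo n)

insertions : ℕ → List ℕ → List (List ℕ)
insertions x []       = (x ∷ []) ∷ []
insertions x (y ∷ ys) = (x ∷ y ∷ ys) ∷ map (y ∷_) (insertions x ys)

perms : List ℕ → List (List ℕ)
perms []       = [] ∷ []
perms (x ∷ xs) = concatMap (insertions x) (perms xs)

des : List ℕ → ℕ
des []           = 0
des (x ∷ [])     = 0
des (x ∷ y ∷ ys) = (if y <ᵇ x then 1 else 0) ℕ.+ des (y ∷ ys)

eulerianA : ℕ → ℚ → ℚ
eulerianA n x = sumℚ (map (λ π → powℚ x (suc (des π))) (perms (range n)))

-- Ordered set partitions of a (duplicate-free) list of elements,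
-- represented as lists of blocks (each block a nonempty list).
-- Generated by inserting the head element either into an existing
-- block or as a new singleton block at any position; each ordered set
-- partition arises exactly once.

addToBlock : ℕ → List (List ℕ) → List (List (List ℕ))
addToBlock x []       = []
addToBlock x (b ∷ bs) = ((x ∷ b) ∷ bs) ∷ map (b ∷_) (addToBlock x bs)

newBlock : ℕ → List (List ℕ) → List (List (List ℕ))
newBlock x []       = ((x ∷ []) ∷ []) ∷ []
newBlock x (b ∷ bs) = ((x ∷ []) ∷ b ∷ bs) ∷ map (b ∷_) (newBlock x bs)

osp : List ℕ → List (List (List ℕ))
osp []       = [] ∷ []
osp (x ∷ xs) = concatMap (λ p → addToBlock x p ++ newBlock x p) (osp xs)

colorings : (α k : ℕ) → List (List (Fin α))
colorings α zero    = [] ∷ []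
colorings α (suc k) = concatMap (λ c → map (c ∷_) (colorings α k)) (allFin α)

ColOSP : ℕ → Set
ColOSP α = List (List ℕ × Fin α)

zipL : {A B : Set} → List A → List B → List (A × B)
zipL []       _        = []
zipL _        []       = []
zipL (a ∷ as) (b ∷ bs) = (a , b) ∷ zipL as bs

colOSP : (α : ℕ) → List ℕ → List (ColOSP α)
colOSP α xs = concatMap (λ p → map (zipL p) (colorings α (length p))) (osp xs)

eqF : {α : ℕ} → Fin α → Fin α → Bool
eqF c d = ⌊ c ≟F d ⌋

alternating : {α : ℕ} → ColOSP α → Bool
alternating []                           = true
alternating (_ ∷ [])                     = true
alternating ((_ , c) ∷ (b , d) ∷ rest) = not (eqF c d) ∧ alternating ((b , d) ∷ rest)

lastColored : {α : ℕ} → Fin α → ColOSP α → Bool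
lastColored β []               = false
lastColored β ((_ , c) ∷ [])   = eqF c β
lastColored β (_ ∷ b ∷ rest)   = lastColored β (b ∷ rest)

isAltColOSP : {α : ℕ} → Fin α → ColOSP α → Bool
isAltColOSP β τ = alternating τ ∧ lastColored β τ

altColOSP : (n α : ℕ) → Fin α → List (ColOSP α)
altColOSP n α β = filter (λ τ → isAltColOSP β τ ≟B true) (colOSP α (range n))

-- Faces of the permutohedron P_m (m ≥ 1) correspond to ordered set
-- partitions σ of the m coordinates; the face has dimension m − #blocks(σ).
-- A face of a product P_{c_1} × ⋯ × P_{c_k} is a tuple of faces, one in
-- each factor, of dimension the sum of the dimensions.  We index the
-- coordinates of the factor P_{c_i} by the elements of the block B_i.

tuples : {A : Set} → List (List A) → List (List A)
tuples []         = [] ∷ []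
tuples (xs ∷ xss) = concatMap (λ x → map (x ∷_) (tuples xss)) xs

-- faces of the copy of P_{c_1} × ⋯ × P_{c_k} indexed by τ:
-- a face is a list (one per block B_i of τ) of pairs (B_i , σ_i) with σ_i an
-- ordered set partition of B_i
Face : Set
Face = List (List ℕ × List (List ℕ))

facesOf : {α : ℕ} → ColOSP α → List Face
facesOf τ = tuples (map (λ bc → map (proj₁ bc ,_) (osp (proj₁ bc))) τ)

faceDim : Face → ℕ
faceDim []             = 0
faceDim ((B , σ) ∷ fs) = (length B ∸ length σ) ℕ.+ faceDim fs

sign : ℕ → ℤ
sign d = (ℤ.- ℤ.1ℤ) ℤ.^ d

-- Euler characteristic of P_n^α (with colors Fin α, distinguished color β):
-- alternating sum over all faces of all cells of the disjoint union
eulerChar : (n α : ℕ) → Fin α → ℤ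
eulerChar n α β =
  sumℤ (map (λ τ → sumℤ (map (λ f → sign (faceDim f)) (facesOf τ))) (altColOSP n α β))

module Submission where

-- Write c = α − 1.  The proof has three steps.
-- 1. Every cell P_{c₁} × ⋯ × P_{c_k} of P_n^α has Euler characteristic 1:
--    the faces of P_m are indexed by the ordered set partitions σ of its m
--    coordinates, and ∑_σ (−1)^(m − #σ) = 1.  So χ(P_n^α) is the number of
--    cells, i.e. of alternating coloured ordered set partitions of [n].
-- 2. A partition with k ≥ 1 blocks has c^(k−1) admissible colourings, so the
--    number of cells is ∑_p c^(#blocks p − 1) over ordered set partitions p.
--    Sums of a weight of #blocks over ordered set partitions, and of a weight
--    of des over permutations, obey first-order recursions in n, intertwined
--    by a binomial transform; this turns the count into
--       ∑_{π ∈ S_n} c^(n−1−des π) · α^(des π).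
-- 3. In ℚ each term equals (c^n/α)·(α/c)^(1+des π); summing gives the claim.

open import Level using (0ℓ)
open import Algebra.Bundles using (CommutativeSemiring)
import Algebra.Properties.CommutativeSemigroup as CommutativeSemigroupProperties
open import Data.Nat as ℕ using (ℕ; zero; suc; z≤n; s≤s)
open import Data.Nat.Properties as ℕₚ using (m≤n⇒m≤1+n)
open import Data.List using (List; []; _∷_; map; foldr; _++_; concatMap; length)
open import Data.List.Relation.Unary.All using (All; []; _∷_)
open import Function using (_∘_)
open import Relation.Binary.PropositionalEquality using (_≡_; refl; sym; trans; cong; cong₂; module ≡-Reasoning)
open import Defs using (osp; addToBlock; newBlock)

module FiniteSums (R : CommutativeSemiring 0ℓ 0ℓ)
                  (≈⇒≡ : ∀ {x y} → CommutativeSemiring._≈_ R x y → x ≡ y) where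

  open CommutativeSemiring R using (Carrier; _+_; _*_; 0#; 1#)
  private
    module R = CommutativeSemiring R
    open CommutativeSemigroupProperties R.+-commutativeSemigroup
      using () renaming (interchange to +-interchange)
  open ≡-Reasoning

  sum : List Carrier → Carrier
  sum = foldr _+_ 0#

  ∑ : {B : Set} → List B → (B → Carrier) → Carrier
  ∑ xs f = sum (map f xs)

  syntax ∑ xs (λ x → e) = ∑[ x ← xs ] e

  fromℕ : ℕ → Carrier
  fromℕ zero    = 0#
  fromℕ (suc k) = 1# + fromℕ k

  +-*-fromℕ : ∀ k x → x + fromℕ k * x ≡ fromℕ (suc k) * x
  +-*-fromℕ k x = begin
    x + fromℕ k * x       ≡⟨ cong (_+ fromℕ k * x) (sym (≈⇒≡ (R.*-identityˡ x))) ⟩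
    1# * x + fromℕ k * x  ≡⟨ sym (≈⇒≡ (R.distribʳ x 1# (fromℕ k))) ⟩
    fromℕ (suc k) * x     ∎

  ∑-++ : {B : Set} (f : B → Carrier) (xs ys : List B) → ∑ (xs ++ ys) f ≡ ∑ xs f + ∑ ys f
  ∑-++ f []       ys = sym (≈⇒≡ (R.+-identityˡ _))
  ∑-++ f (x ∷ xs) ys = trans (cong (f x +_) (∑-++ f xs ys)) (sym (≈⇒≡ (R.+-assoc (f x) _ _)))

  ∑-concatMap : {B C : Set} (f : C → Carrier) (g : B → List C) (xs : List B) →
    ∑ (concatMap g xs) f ≡ ∑[ x ← xs ] ∑ (g x) f
  ∑-concatMap f g []       = refl
  ∑-concatMap f g (x ∷ xs) = begin
    ∑ (g x ++ concatMap g xs) f           ≡⟨ ∑-++ f (g x) (concatMap g xs) ⟩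
    ∑ (g x) f + ∑ (concatMap g xs) f      ≡⟨ cong (∑ (g x) f +_) (∑-concatMap f g xs) ⟩
    ∑ (g x) f + ∑[ x′ ← xs ] ∑ (g x′) f   ∎

  ∑-map : {B C : Set} (f : C → Carrier) (g : B → C) (xs : List B) → ∑ (map g xs) f ≡ ∑ xs (f ∘ g)
  ∑-map f g []       = refl
  ∑-map f g (x ∷ xs) = cong (f (g x) +_) (∑-map f g xs)

  ∑-cong : {B : Set} {f g : B → Carrier} → (∀ x → f x ≡ g x) → ∀ xs → ∑ xs f ≡ ∑ xs g
  ∑-cong f≗g []       = refl
  ∑-cong f≗g (x ∷ xs) = cong₂ _+_ (f≗g x) (∑-cong f≗g xs)

  ∑-congAll : {B : Set} {f g : B → Carrier} {xs : List B} → All (λ x → f x ≡ g x) xs → ∑ xs f ≡ ∑ xs g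
  ∑-congAll []         = refl
  ∑-congAll (fx≡gx ∷ e) = cong₂ _+_ fx≡gx (∑-congAll e)

  ∑-*ˡ : {B : Set} (k : Carrier) (f : B → Carrier) (xs : List B) → ∑[ x ← xs ] (k * f x) ≡ k * ∑ xs f
  ∑-*ˡ k f []       = sym (≈⇒≡ (R.zeroʳ k))
  ∑-*ˡ k f (x ∷ xs) = trans (cong (k * f x +_) (∑-*ˡ k f xs)) (sym (≈⇒≡ (R.distribˡ k (f x) _)))

  ∑-*ʳ : {B : Set} (k : Carrier) (f : B → Carrier) (xs : List B) → ∑[ x ← xs ] (f x * k) ≡ ∑ xs f * k
  ∑-*ʳ k f xs = begin
    ∑[ x ← xs ] (f x * k) ≡⟨ ∑-cong (λ x → ≈⇒≡ (R.*-comm (f x) k)) xs ⟩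
    ∑[ x ← xs ] (k * f x) ≡⟨ ∑-*ˡ k f xs ⟩
    k * ∑ xs f            ≡⟨ ≈⇒≡ (R.*-comm k _) ⟩
    ∑ xs f * k            ∎

  ∑-+ : {B : Set} (f g : B → Carrier) (xs : List B) → ∑[ x ← xs ] (f x + g x) ≡ ∑ xs f + ∑ xs g
  ∑-+ f g []       = sym (≈⇒≡ (R.+-identityˡ 0#))
  ∑-+ f g (x ∷ xs) = trans (cong (f x + g x +_) (∑-+ f g xs)) (≈⇒≡ (+-interchange (f x) (g x) _ _))

  ∑-zero : {B : Set} (xs : List B) → ∑[ x ← xs ] 0# ≡ 0#
  ∑-zero []       = refl
  ∑-zero (x ∷ xs) = trans (≈⇒≡ (R.+-identityˡ _)) (∑-zero xs)

  ∑-swap : {B C : Set} (f : B → C → Carrier) (xs : List B) (ys : List C) →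
    ∑[ x ← xs ] ∑[ y ← ys ] f x y ≡ ∑[ y ← ys ] ∑[ x ← xs ] f x y
  ∑-swap f []       ys = sym (∑-zero ys)
  ∑-swap f (x ∷ xs) ys = trans (cong (∑ ys (f x) +_) (∑-swap f xs ys))
                               (sym (∑-+ (f x) (λ y → ∑[ x′ ← xs ] f x′ y) ys))

  ∑-one : {B : Set} (xs : List B) → ∑[ x ← xs ] 1# ≡ fromℕ (length xs)
  ∑-one []       = refl
  ∑-one (x ∷ xs) = cong (1# +_) (∑-one xs)

-- A new element is added
-- to an ordered set partition with k blocks either to one of its k blocks or
-- as a new singleton block in one of k+1 positions.  Hence the block-count
-- statistic ∑_p g(#blocks p) over the ordered set partitions of an n-element
-- list is blockSum n g, computed by n applications of addElement.
module BlockCounts (R : CommutativeSemiring 0ℓ 0ℓ)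
                   (≈⇒≡ : ∀ {x y} → CommutativeSemiring._≈_ R x y → x ≡ y) where

  open CommutativeSemiring R using (Carrier; _+_; _*_)
  open FiniteSums R ≈⇒≡
  private module R = CommutativeSemiring R
  open ≡-Reasoning

  addElement : (ℕ → Carrier) → ℕ → Carrier
  addElement g k = fromℕ k * g k + fromℕ (suc k) * g (suc k)

  blockSum : ℕ → (ℕ → Carrier) → Carrier
  blockSum zero    g = g 0
  blockSum (suc n) g = blockSum n (addElement g)

  ∑-addToBlock : ∀ x (g : ℕ → Carrier) p →
    ∑[ q ← addToBlock x p ] g (length q) ≡ fromℕ (length p) * g (length p)
  ∑-addToBlock x g []       = sym (≈⇒≡ (R.zeroˡ _))
  ∑-addToBlock x g (b ∷ bs) = begin
    g k + ∑[ q ← map (b ∷_) (addToBlock x bs) ] g (length q)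
      ≡⟨ cong (g k +_) (trans (∑-map (g ∘ length) (b ∷_) (addToBlock x bs)) (∑-addToBlock x (g ∘ suc) bs)) ⟩
    g k + fromℕ (length bs) * g k
      ≡⟨ +-*-fromℕ (length bs) (g k) ⟩
    fromℕ k * g k ∎
    where
    k : ℕ
    k = suc (length bs)

  ∑-newBlock : ∀ x (g : ℕ → Carrier) p →
    ∑[ q ← newBlock x p ] g (length q) ≡ fromℕ (suc (length p)) * g (suc (length p))
  ∑-newBlock x g []       = trans (cong (g 1 +_) (sym (≈⇒≡ (R.zeroˡ (g 1))))) (+-*-fromℕ 0 (g 1))
  ∑-newBlock x g (b ∷ bs) = begin
    g k + ∑[ q ← map (b ∷_) (newBlock x bs) ] g (length q)
      ≡⟨ cong (g k +_) (trans (∑-map (g ∘ length) (b ∷_) (newBlock x bs)) (∑-newBlock x (g ∘ suc) bs)) ⟩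
    g k + fromℕ (suc (length bs)) * g k
      ≡⟨ +-*-fromℕ (suc (length bs)) (g k) ⟩
    fromℕ k * g k ∎
    where
    k : ℕ
    k = suc (suc (length bs))

  ∑-osp : ∀ L (g : ℕ → Carrier) → ∑[ p ← osp L ] g (length p) ≡ blockSum (length L) g
  ∑-osp []       g = ≈⇒≡ (R.+-identityʳ (g 0))
  ∑-osp (x ∷ xs) g = begin
    ∑[ q ← osp (x ∷ xs) ] g (length q)
      ≡⟨ ∑-concatMap (g ∘ length) (λ p → addToBlock x p ++ newBlock x p) (osp xs) ⟩
    ∑[ p ← osp xs ] ∑[ q ← addToBlock x p ++ newBlock x p ] g (length q)
      ≡⟨ ∑-cong extend (osp xs) ⟩
    ∑[ p ← osp xs ] addElement g (length p)
      ≡⟨ ∑-osp xs (addElement g) ⟩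
    blockSum (length xs) (addElement g) ∎
    where
    extend : ∀ p → ∑[ q ← addToBlock x p ++ newBlock x p ] g (length q) ≡ addElement g (length p)
    extend p = trans (∑-++ (g ∘ length) (addToBlock x p) (newBlock x p))
                     (cong₂ _+_ (∑-addToBlock x g p) (∑-newBlock x g p))

  blockSum-cong≤ : ∀ n (g h : ℕ → Carrier) → (∀ k → k ℕ.≤ n → g k ≡ h k) → blockSum n g ≡ blockSum n h
  blockSum-cong≤ zero    g h g≡h = g≡h 0 z≤n
  blockSum-cong≤ (suc n) g h g≡h = blockSum-cong≤ n (addElement g) (addElement h) step
    where
    step : ∀ k → k ℕ.≤ n → addElement g k ≡ addElement h k
    step k k≤n = cong₂ (λ u v → fromℕ k * u + fromℕ (suc k) * v)
                       (g≡h k (m≤n⇒m≤1+n k≤n)) (g≡h (suc k) (s≤s k≤n))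

module Descents where

  open import Data.Nat using (ℕ; zero; suc; _+_; _*_; _∸_; _<_; _≤_; _<ᵇ_; z≤n; s≤s)
  open import Data.Nat.Properties as ℕₚ using (m≤n⇒m≤1+n)
  open import Data.Nat.Solver using (module +-*-Solver)
  open import Data.Bool using (Bool; true; false; if_then_else_)
  open import Data.Product using (_×_; _,_)
  open import Data.Unit using (⊤; tt)
  open import Data.List using (List; []; _∷_; map; concatMap; length; applyUpTo)
  open import Data.List.Properties using (length-map; length-applyUpTo)
  open import Data.List.Relation.Unary.All as All using (All; []; _∷_)
  open import Data.List.Relation.Unary.All.Properties using (map⁺; concat⁺; applyUpTo⁺₁)
  open import Function using (_∘_)
  open import Relation.Binary.PropositionalEquality using (_≡_; refl; sym; trans; cong; cong₂; subst; module ≡-Reasoning)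
  open import Defs using (des; insertions; perms; range)
  open +-*-Solver using (solve; _:+_; _:*_; _:=_; con)
  open FiniteSums ℕₚ.+-*-commutativeSemiring (λ e → e) using (∑; ∑-map; ∑-concatMap; ∑-congAll)
  open ≡-Reasoning

  ind : Bool → ℕ
  ind b = if b then 1 else 0

  <ᵇ-true : ∀ {m n} → m < n → (m <ᵇ n) ≡ true
  <ᵇ-true {zero}  {suc n} _         = refl
  <ᵇ-true {suc m} {suc n} (s≤s m<n) = <ᵇ-true m<n

  <ᵇ-false : ∀ {m n} → m < n → (n <ᵇ m) ≡ false
  <ᵇ-false {zero}  {suc n} _         = refl
  <ᵇ-false {suc m} {suc n} (s≤s m<n) = <ᵇ-false m<n

  -- ascents: positions i with π(i) < π(i+1) (the entries are distinct)
  asc : List ℕ → ℕ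
  asc []           = 0
  asc (x ∷ [])     = 0
  asc (x ∷ y ∷ ys) = (if y <ᵇ x then 0 else 1) + asc (y ∷ ys)

  des+asc : ∀ y ys → des (y ∷ ys) + asc (y ∷ ys) ≡ length ys
  des+asc y []       = refl
  des+asc y (z ∷ zs) with z <ᵇ y
  ... | true  = cong suc (des+asc z zs)
  ... | false = trans (ℕₚ.+-suc (des (z ∷ zs)) (asc (z ∷ zs))) (cong suc (des+asc z zs))

  des≤length : ∀ y ys → des (y ∷ ys) ≤ length ys
  des≤length y ys = subst (des (y ∷ ys) ≤_) (des+asc y ys) (ℕₚ.m≤m+n _ _)

  -- Inserting a new minimum into a permutation of length m with d descents:
  -- at the front or inside one of the d descents keeps d descents (d+1 ways),
  -- inside one of the m−1−d ascents or at the end creates one more (m−d ways).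
  -- So over the permutations of an increasing n-list, ∑_π h(des π) is
  -- descentSum n h, computed by n applications of insertMin.
  insertMin : ℕ → (ℕ → ℕ) → ℕ → ℕ
  insertMin m h d = suc d * h d + (m ∸ d) * h (suc d)

  descentSum : ℕ → (ℕ → ℕ) → ℕ
  descentSum zero    h = h 0
  descentSum (suc n) h = descentSum n (insertMin n h)

  descentSum-cong≤ : ∀ n (g h : ℕ → ℕ) → (∀ d → d ≤ n → g d ≡ h d) → descentSum n g ≡ descentSum n h
  descentSum-cong≤ zero    g h g≡h = g≡h 0 z≤n
  descentSum-cong≤ (suc n) g h g≡h = descentSum-cong≤ n (insertMin n g) (insertMin n h) step
    where
    step : ∀ d → d ≤ n → insertMin n g d ≡ insertMin n h d
    step d d≤n = cong₂ (λ u v → suc d * u + (n ∸ d) * v) (g≡h d (m≤n⇒m≤1+n d≤n)) (g≡h (suc d) (s≤s d≤n))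

  ∑-insertions-behind : ∀ x y ys (h : ℕ → ℕ) → x < y → All (x <_) ys →
    ∑[ q ← insertions x ys ] h (des (y ∷ q)) ≡
      des (y ∷ ys) * h (des (y ∷ ys)) + suc (asc (y ∷ ys)) * h (suc (des (y ∷ ys)))
  ∑-insertions-behind x y [] h x<y [] = begin
    h (ind (x <ᵇ y) + 0) + 0   ≡⟨ cong (λ b → h (ind b + 0) + 0) (<ᵇ-true x<y) ⟩
    h 1 + 0                    ≡⟨ solve 2 (λ u v → u :+ con 0 := con 0 :* v :+ con 1 :* u) refl (h 1) (h 0) ⟩
    0 * h 0 + 1 * h 1          ∎
  ∑-insertions-behind x y (z ∷ zs) h x<y (x<z ∷ x<zs) = begin
    h (ind (x <ᵇ y) + (ind (z <ᵇ x) + D)) + ∑[ q ← map (z ∷_) (insertions x zs) ] h (des (y ∷ q))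
      ≡⟨ cong₂ (λ b b′ → h (ind b + (ind b′ + D)) + rest) (<ᵇ-true x<y) (<ᵇ-false x<z) ⟩
    h (suc D) + ∑[ q ← map (z ∷_) (insertions x zs) ] h (des (y ∷ q))
      ≡⟨ cong (h (suc D) +_) (∑-map (λ q → h (des (y ∷ q))) (z ∷_) (insertions x zs)) ⟩
    h (suc D) + ∑[ q ← insertions x zs ] h (ind (z <ᵇ y) + des (z ∷ q))
      ≡⟨ cong (h (suc D) +_) (∑-insertions-behind x z zs (λ d → h (ind (z <ᵇ y) + d)) x<z x<zs) ⟩
    h (suc D) + (D * h (ind (z <ᵇ y) + D) + suc A * h (ind (z <ᵇ y) + suc D))
      ≡⟨ regroup (z <ᵇ y) ⟩
    des (y ∷ z ∷ zs) * h (des (y ∷ z ∷ zs)) + suc (asc (y ∷ z ∷ zs)) * h (suc (des (y ∷ z ∷ zs))) ∎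
    where
    D A rest : ℕ
    D = des (z ∷ zs)
    A = asc (z ∷ zs)
    rest = ∑[ q ← map (z ∷_) (insertions x zs) ] h (des (y ∷ q))
    regroup : ∀ b → h (suc D) + (D * h (ind b + D) + suc A * h (ind b + suc D)) ≡
      (ind b + D) * h (ind b + D) + suc ((if b then 0 else 1) + A) * h (suc (ind b + D))
    regroup true  = solve 4 (λ d a u v → u :+ (d :* u :+ (con 1 :+ a) :* v) := (con 1 :+ d) :* u :+ (con 1 :+ a) :* v)
                      refl D A (h (suc D)) (h (suc (suc D)))
    regroup false = solve 4 (λ d a u v → v :+ (d :* u :+ (con 1 :+ a) :* v) := d :* u :+ (con 2 :+ a) :* v)
                      refl D A (h D) (h (suc D))

  ∑-insertions : ∀ x σ (h : ℕ → ℕ) → All (x <_) σ →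
    ∑[ q ← insertions x σ ] h (des q) ≡ insertMin (length σ) h (des σ)
  ∑-insertions x [] h [] = solve 2 (λ u v → u :+ con 0 := con 1 :* u :+ con 0 :* v) refl (h 0) (h 1)
  ∑-insertions x (y ∷ ys) h (x<y ∷ x<ys) = begin
    h (ind (y <ᵇ x) + D) + ∑[ q ← map (y ∷_) (insertions x ys) ] h (des q)
      ≡⟨ cong (λ b → h (ind b + D) + rest) (<ᵇ-false x<y) ⟩
    h D + ∑[ q ← map (y ∷_) (insertions x ys) ] h (des q)
      ≡⟨ cong (h D +_) (∑-map (h ∘ des) (y ∷_) (insertions x ys)) ⟩
    h D + ∑[ q ← insertions x ys ] h (des (y ∷ q))
      ≡⟨ cong (h D +_) (∑-insertions-behind x y ys h x<y x<ys) ⟩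
    h D + (D * h D + suc A * h (suc D))
      ≡⟨ solve 4 (λ d a u v → u :+ (d :* u :+ (con 1 :+ a) :* v) := (con 1 :+ d) :* u :+ (con 1 :+ a) :* v)
           refl D A (h D) (h (suc D)) ⟩
    suc D * h D + suc A * h (suc D)
      ≡⟨ cong (λ k → suc D * h D + k * h (suc D)) (sym ascents) ⟩
    suc D * h D + (suc (length ys) ∸ D) * h (suc D) ∎
    where
    D A rest : ℕ
    D = des (y ∷ ys)
    A = asc (y ∷ ys)
    rest = ∑[ q ← map (y ∷_) (insertions x ys) ] h (des q)
    ascents : suc (length ys) ∸ D ≡ suc A
    ascents = begin
      suc (length ys) ∸ D     ≡⟨ cong (λ l → suc l ∸ D) (sym (des+asc y ys)) ⟩
      suc (D + A) ∸ D         ≡⟨ ℕₚ.+-∸-assoc 1 (ℕₚ.m≤m+n D A) ⟩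
      suc (D + A ∸ D)         ≡⟨ cong suc (ℕₚ.m+n∸m≡n D A) ⟩
      suc A                   ∎

  Increasing : List ℕ → Set
  Increasing []       = ⊤
  Increasing (x ∷ xs) = All (x <_) xs × Increasing xs

  All-insertions : ∀ {P : ℕ → Set} x σ → P x → All P σ → All (All P) (insertions x σ)
  All-insertions x []       px []         = (px ∷ []) ∷ []
  All-insertions x (y ∷ ys) px (py ∷ pys) =
    (px ∷ py ∷ pys) ∷ map⁺ (All.map (py ∷_) (All-insertions x ys px pys))

  All-perms : ∀ {P : ℕ → Set} xs → All P xs → All (All P) (perms xs)
  All-perms []       []         = [] ∷ []
  All-perms (x ∷ xs) (px ∷ pxs) =
    concat⁺ (map⁺ (All.map (λ {σ} pσ → All-insertions x σ px pσ) (All-perms xs pxs)))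

  length-insertions : ∀ x σ → All (λ q → length q ≡ suc (length σ)) (insertions x σ)
  length-insertions x []       = refl ∷ []
  length-insertions x (y ∷ ys) = refl ∷ map⁺ (All.map (cong suc) (length-insertions x ys))

  length-perms : ∀ xs → All (λ π → length π ≡ length xs) (perms xs)
  length-perms []       = refl ∷ []
  length-perms (x ∷ xs) =
    concat⁺ (map⁺ (All.map (λ {σ} |σ| → All.map (λ |q| → trans |q| (cong suc |σ|)) (length-insertions x σ))
                           (length-perms xs)))

  ∑-perms : ∀ L → Increasing L → (h : ℕ → ℕ) → ∑[ π ← perms L ] h (des π) ≡ descentSum (length L) h
  ∑-perms []       _            h = ℕₚ.+-identityʳ (h 0)
  ∑-perms (x ∷ xs) (x<xs , inc) h = begin
    ∑[ π ← concatMap (insertions x) (perms xs) ] h (des π)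
      ≡⟨ ∑-concatMap (h ∘ des) (insertions x) (perms xs) ⟩
    ∑[ σ ← perms xs ] ∑[ π ← insertions x σ ] h (des π)
      ≡⟨ ∑-congAll (All.zipWith insert (All-perms xs x<xs , length-perms xs)) ⟩
    ∑[ σ ← perms xs ] insertMin (length xs) h (des σ)
      ≡⟨ ∑-perms xs inc (insertMin (length xs) h) ⟩
    descentSum (length xs) (insertMin (length xs) h) ∎
    where
    insert : ∀ {σ} → All (x <_) σ × length σ ≡ length xs →
      ∑[ π ← insertions x σ ] h (des π) ≡ insertMin (length xs) h (des σ)
    insert {σ} (x<σ , |σ|) = trans (∑-insertions x σ h x<σ) (cong (λ l → insertMin l h (des σ)) |σ|)

  StrictlyMonotone : (ℕ → ℕ) → Set
  StrictlyMonotone f = ∀ {i j} → i < j → f i < f j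

  Increasing-applyUpTo : ∀ f n → StrictlyMonotone f → Increasing (applyUpTo f n)
  Increasing-applyUpTo f zero    mono = tt
  Increasing-applyUpTo f (suc n) mono =
    applyUpTo⁺₁ (f ∘ suc) n (λ _ → mono (s≤s z≤n)) , Increasing-applyUpTo (f ∘ suc) n (mono ∘ s≤s)

  Increasing-map : ∀ f xs → StrictlyMonotone f → Increasing xs → Increasing (map f xs)
  Increasing-map f []       mono tt           = tt
  Increasing-map f (x ∷ xs) mono (x<xs , inc) = map⁺ (All.map mono x<xs) , Increasing-map f xs mono inc

  Increasing-range : ∀ n → Increasing (range n)
  Increasing-range n = Increasing-map suc _ s≤s (Increasing-applyUpTo (λ i → i) n (λ i<j → i<j))

  length-range : ∀ n → length (range n) ≡ n
  length-range n = trans (length-map suc (applyUpTo (λ i → i) n)) (length-applyUpTo (λ i → i) n)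

  des-perms-range : ∀ m → All (λ π → des π ≤ m) (perms (range (suc m)))
  des-perms-range m = All.map (λ {π} → bound {π}) (length-perms (range (suc m)))
    where
    bound : ∀ {π} → length π ≡ length (range (suc m)) → des π ≤ m
    bound {[]}     ()
    bound {y ∷ ys} |π| = subst (des (y ∷ ys) ≤_) (ℕₚ.suc-injective (trans |π| (length-range (suc m)))) (des≤length y ys)

module BinomialTransform where

  open import Data.Nat using (ℕ; zero; suc; _+_; _*_; _∸_; _≤_; _^_; z≤n; s≤s)
  open import Data.Nat.Properties as ℕₚ using (m≤n⇒m≤1+n)
  open import Data.Nat.Solver using (module +-*-Solver)
  open import Function using (_∘_)
  open import Relation.Binary.PropositionalEquality using (_≡_; refl; sym; trans; cong; cong₂; module ≡-Reasoning)
  open Descents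
  open +-*-Solver using (solve; _:+_; _:*_; _:=_; con)
  open FiniteSums ℕₚ.+-*-commutativeSemiring (λ e → e) using (fromℕ)
  open BlockCounts ℕₚ.+-*-commutativeSemiring (λ e → e) using (addElement; blockSum)
  open ≡-Reasoning

  fromℕ-id : ∀ k → fromℕ k ≡ k
  fromℕ-id zero    = refl
  fromℕ-id (suc k) = cong suc (fromℕ-id k)

  -- binomialSum f d = ∑_{i ≤ d} C(d,i)·f(i), defined through Pascal's rule
  binomialSum : (ℕ → ℕ) → ℕ → ℕ
  binomialSum f zero    = f 0
  binomialSum f (suc d) = binomialSum f d + binomialSum (f ∘ suc) d

  binomialSum-cong≤ : ∀ d (f g : ℕ → ℕ) → (∀ i → i ≤ d → f i ≡ g i) → binomialSum f d ≡ binomialSum g d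
  binomialSum-cong≤ zero    f g f≡g = f≡g 0 z≤n
  binomialSum-cong≤ (suc d) f g f≡g =
    cong₂ _+_ (binomialSum-cong≤ d f g (λ i i≤d → f≡g i (m≤n⇒m≤1+n i≤d)))
              (binomialSum-cong≤ d (f ∘ suc) (g ∘ suc) (λ i i≤d → f≡g (suc i) (s≤s i≤d)))

  -- The binomial transform intertwines "add an element" with "insert a minimum":
  -- with m = d + k,  ∑_i C(d,i)·((m−i)·f(i+1) + (m+1−i)·f(i))
  --                    = (d+1)·∑_i C(d,i)·f(i) + k·∑_i C(d+1,i)·f(i).
  binomialSum-step : ∀ d k f →
    binomialSum (λ i → (d + k ∸ i) * f (suc i) + (suc (d + k) ∸ i) * f i) d ≡
      suc d * binomialSum f d + k * binomialSum f (suc d)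
  binomialSum-step zero k f =
    solve 3 (λ k a b → k :* b :+ (con 1 :+ k) :* a := (con 1 :+ con 0) :* a :+ k :* (a :+ b)) refl k (f 0) (f 1)
  binomialSum-step (suc d) k f = begin
    binomialSum (λ i → (suc (d + k) ∸ i) * f (suc i) + (suc (suc (d + k)) ∸ i) * f i) d + shifted
      ≡⟨ cong (λ m → binomialSum (λ i → (m ∸ i) * f (suc i) + (suc m ∸ i) * f i) d + shifted)
              (sym (ℕₚ.+-suc d k)) ⟩
    binomialSum (λ i → (d + suc k ∸ i) * f (suc i) + (suc (d + suc k) ∸ i) * f i) d + shifted
      ≡⟨ cong₂ _+_ (binomialSum-step d (suc k) f) (binomialSum-step d k (f ∘ suc)) ⟩
    (suc d * a + suc k * (a + b)) + (suc d * b + k * c)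
      ≡⟨ solve 5 (λ d k a b c → ((con 1 :+ d) :* a :+ (con 1 :+ k) :* (a :+ b)) :+ ((con 1 :+ d) :* b :+ k :* c)
                    := (con 2 :+ d) :* (a :+ b) :+ k :* ((a :+ b) :+ c)) refl d k a b c ⟩
    suc (suc d) * binomialSum f (suc d) + k * binomialSum f (suc (suc d)) ∎
    where
    shifted a b c : ℕ
    shifted = binomialSum (λ i → (d + k ∸ i) * f (suc (suc i)) + (suc (d + k) ∸ i) * f (suc i)) d
    a = binomialSum f d
    b = binomialSum (f ∘ suc) d
    c = binomialSum (f ∘ suc) (suc d)

  toDescentWeight : ℕ → (ℕ → ℕ) → ℕ → ℕ
  toDescentWeight n g = binomialSum (λ i → g (n ∸ i))

  blockSum≡descentSum : ∀ n g → blockSum n g ≡ descentSum n (toDescentWeight n g)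
  blockSum≡descentSum zero    g = refl
  blockSum≡descentSum (suc n) g =
    trans (blockSum≡descentSum n (addElement g)) (descentSum-cong≤ n _ _ commute)
    where
    f : ℕ → ℕ
    f i = g (suc n ∸ i)
    addElement-shift : ∀ i → i ≤ n → addElement g (n ∸ i) ≡ (n ∸ i) * f (suc i) + (suc n ∸ i) * f i
    addElement-shift i i≤n = begin
      fromℕ (n ∸ i) * g (n ∸ i) + fromℕ (suc (n ∸ i)) * g (suc (n ∸ i))
        ≡⟨ cong₂ (λ u v → u * g (n ∸ i) + v * g (suc (n ∸ i))) (fromℕ-id (n ∸ i)) (fromℕ-id (suc (n ∸ i))) ⟩
      (n ∸ i) * g (n ∸ i) + suc (n ∸ i) * g (suc (n ∸ i))
        ≡⟨ cong (λ m → (n ∸ i) * g (n ∸ i) + m * g m) (sym (ℕₚ.+-∸-assoc 1 i≤n)) ⟩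
      (n ∸ i) * f (suc i) + (suc n ∸ i) * f i ∎
    commute : ∀ d → d ≤ n → toDescentWeight n (addElement g) d ≡ insertMin n (toDescentWeight (suc n) g) d
    commute d d≤n = begin
      binomialSum (λ i → addElement g (n ∸ i)) d
        ≡⟨ binomialSum-cong≤ d _ _ (λ i i≤d → addElement-shift i (ℕₚ.≤-trans i≤d d≤n)) ⟩
      binomialSum (λ i → (n ∸ i) * f (suc i) + (suc n ∸ i) * f i) d
        ≡⟨ cong (λ m → binomialSum (λ i → (m ∸ i) * f (suc i) + (suc m ∸ i) * f i) d) (sym (ℕₚ.m+[n∸m]≡n d≤n)) ⟩
      binomialSum (λ i → (d + (n ∸ d) ∸ i) * f (suc i) + (suc (d + (n ∸ d)) ∸ i) * f i) d
        ≡⟨ binomialSum-step d (n ∸ d) f ⟩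
      insertMin n (toDescentWeight (suc n) g) d ∎

  binomialTheorem : ∀ c d k → binomialSum (λ i → c ^ (d + k ∸ i)) d ≡ c ^ k * suc c ^ d
  binomialTheorem c zero    k = sym (ℕₚ.*-identityʳ (c ^ k))
  binomialTheorem c (suc d) k = begin
    binomialSum (λ i → c ^ (suc (d + k) ∸ i)) d + binomialSum (λ i → c ^ (d + k ∸ i)) d
      ≡⟨ cong (λ m → binomialSum (λ i → c ^ (m ∸ i)) d + binomialSum (λ i → c ^ (d + k ∸ i)) d)
              (sym (ℕₚ.+-suc d k)) ⟩
    binomialSum (λ i → c ^ (d + suc k ∸ i)) d + binomialSum (λ i → c ^ (d + k ∸ i)) d
      ≡⟨ cong₂ _+_ (binomialTheorem c d (suc k)) (binomialTheorem c d k) ⟩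
    c * c ^ k * suc c ^ d + c ^ k * suc c ^ d
      ≡⟨ solve 3 (λ c x y → c :* x :* y :+ x :* y := x :* ((con 1 :+ c) :* y)) refl c (c ^ k) (suc c ^ d) ⟩
    c ^ k * suc c ^ suc d ∎

  toDescentWeight-pow : ∀ c n d → d ≤ n → toDescentWeight n (c ^_) d ≡ c ^ (n ∸ d) * suc c ^ d
  toDescentWeight-pow c n d d≤n =
    trans (cong (λ m → binomialSum (λ i → c ^ (m ∸ i)) d) (sym (ℕₚ.m+[n∸m]≡n d≤n))) (binomialTheorem c d (n ∸ d))

-- Step 1: the Euler characteristic of P_n^α is its number of cells.
module EulerCharacteristic where

  open import Data.Nat using (ℕ; zero; suc; _∸_; _≤_)
  open import Data.Nat.Properties as ℕₚ using ()
  open import Data.Integer using (+_; 1ℤ; -_; _+_; _*_)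
  open import Data.Integer.Properties as ℤₚ using ()
  open import Data.Integer.Solver using (module +-*-Solver)
  open import Data.Product using (_×_; _,_; proj₁; proj₂)
  open import Data.List using (List; []; _∷_; map; concatMap; length)
  open import Function using (_∘_)
  open import Relation.Binary.PropositionalEquality using (_≡_; refl; sym; trans; cong; module ≡-Reasoning)
  open import Defs using (osp; sign; Face; facesOf; faceDim; ColOSP; eulerChar; altColOSP)
  open +-*-Solver using (solve; _:+_; _:*_; _:=_; :-_; con)
  open FiniteSums ℤₚ.+-*-commutativeSemiring (λ e → e)
  open BlockCounts ℤₚ.+-*-commutativeSemiring (λ e → e) using (addElement; blockSum; ∑-osp; blockSum-cong≤)
  open ≡-Reasoning

  fromℕ-pos : ∀ k → fromℕ k ≡ + k
  fromℕ-pos zero    = refl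
  fromℕ-pos (suc k) = trans (cong (λ v → 1ℤ + v) (fromℕ-pos k)) (sym (ℤₚ.pos-+ 1 k))

  blockSum-sign : ∀ n → blockSum n (λ k → sign (n ∸ k)) ≡ 1ℤ
  blockSum-sign zero    = refl
  blockSum-sign (suc n) = trans (blockSum-cong≤ n _ _ cancel) (blockSum-sign n)
    where
    cancel : ∀ k → k ≤ n → addElement (λ k → sign (suc n ∸ k)) k ≡ sign (n ∸ k)
    cancel k k≤n = begin
      fromℕ k * sign (suc n ∸ k) + fromℕ (suc k) * sign (n ∸ k)
        ≡⟨ cong (λ m → fromℕ k * sign m + fromℕ (suc k) * sign (n ∸ k)) (ℕₚ.+-∸-assoc 1 k≤n) ⟩
      fromℕ k * (- 1ℤ * sign (n ∸ k)) + (1ℤ + fromℕ k) * sign (n ∸ k)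
        ≡⟨ solve 2 (λ u s → u :* (:- con 1ℤ :* s) :+ (con 1ℤ :+ u) :* s := s) refl (fromℕ k) (sign (n ∸ k)) ⟩
      sign (n ∸ k) ∎

  -- The faces of the permutohedron P_B are indexed by the ordered set
  -- partitions σ of B, of dimension |B| − #σ; so its Euler characteristic is 1.
  eulerChar-permutohedron : ∀ B → ∑[ σ ← osp B ] sign (length B ∸ length σ) ≡ 1ℤ
  eulerChar-permutohedron B = trans (∑-osp B (λ k → sign (length B ∸ k))) (blockSum-sign (length B))

  -- each cell P_{c₁} × ⋯ × P_{c_k} of P_n^α has Euler characteristic 1,
  -- since faces of a product are tuples of faces and dimensions add
  eulerChar-cell : ∀ {α} (τ : ColOSP α) → ∑[ f ← facesOf τ ] sign (faceDim f) ≡ 1ℤ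
  eulerChar-cell []             = refl
  eulerChar-cell ((B , _) ∷ τ) = begin
    ∑[ f ← concatMap (λ x → map (x ∷_) others) firstFaces ] sign (faceDim f)
      ≡⟨ ∑-concatMap (sign ∘ faceDim) (λ x → map (x ∷_) others) firstFaces ⟩
    ∑[ x ← firstFaces ] ∑[ f ← map (x ∷_) others ] sign (faceDim f)
      ≡⟨ ∑-cong (λ x → trans (∑-map (sign ∘ faceDim) (x ∷_) others) (factor x)) firstFaces ⟩
    ∑[ x ← firstFaces ] sign (length (proj₁ x) ∸ length (proj₂ x))
      ≡⟨ ∑-map (λ x → sign (length (proj₁ x) ∸ length (proj₂ x))) (B ,_) (osp B) ⟩
    ∑[ σ ← osp B ] sign (length B ∸ length σ)
      ≡⟨ eulerChar-permutohedron B ⟩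
    1ℤ ∎
    where
    firstFaces : List (List ℕ × List (List ℕ))
    firstFaces = map (B ,_) (osp B)
    others : List Face
    others = facesOf τ
    factor : ∀ x → ∑[ f ← others ] sign (length (proj₁ x) ∸ length (proj₂ x) ℕ.+ faceDim f)
                     ≡ sign (length (proj₁ x) ∸ length (proj₂ x))
    factor x = begin
      ∑[ f ← others ] sign (d ℕ.+ faceDim f)    ≡⟨ ∑-cong (λ f → ℤₚ.^-distribˡ-+-* (- 1ℤ) d (faceDim f)) others ⟩
      ∑[ f ← others ] (sign d * sign (faceDim f)) ≡⟨ ∑-*ˡ (sign d) (sign ∘ faceDim) others ⟩
      sign d * ∑[ f ← others ] sign (faceDim f)   ≡⟨ cong (sign d *_) (eulerChar-cell τ) ⟩
      sign d * 1ℤ                                 ≡⟨ ℤₚ.*-identityʳ (sign d) ⟩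
      sign d ∎
      where
      d : ℕ
      d = length (proj₁ x) ∸ length (proj₂ x)

  eulerChar≡count : ∀ n α β → eulerChar n α β ≡ + length (altColOSP n α β)
  eulerChar≡count n α β = begin
    ∑[ τ ← altColOSP n α β ] ∑[ f ← facesOf τ ] sign (faceDim f) ≡⟨ ∑-cong eulerChar-cell (altColOSP n α β) ⟩
    ∑[ τ ← altColOSP n α β ] 1ℤ                                  ≡⟨ ∑-one (altColOSP n α β) ⟩
    fromℕ (length (altColOSP n α β))                              ≡⟨ fromℕ-pos _ ⟩
    + length (altColOSP n α β) ∎

-- Step 2: counting the cells of P_n^α.
module Colourings where

  open import Data.Nat using (ℕ; zero; suc; _+_; _*_; _∸_; _≤_; _^_)
  open import Data.Nat.Properties as ℕₚ using ()
  open import Data.Bool using (Bool; true; false; not; _∧_)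
  open import Data.Bool.Properties using (∧-assoc) renaming (_≟_ to _≟B_)
  open import Data.Fin using (Fin; zero; suc)
  open import Data.Fin.Properties using () renaming (_≟_ to _≟F_)
  open import Data.List using (List; []; _∷_; map; length; filter; allFin)
  open import Data.List.Properties using (map-tabulate; length-tabulate)
  open import Data.List.Relation.Unary.All as All using (All; []; _∷_)
  open import Data.List.Relation.Unary.All.Properties using (map⁺; concat⁺)
  open import Relation.Nullary using (yes; no)
  open import Relation.Binary.PropositionalEquality using (_≡_; refl; sym; trans; cong; module ≡-Reasoning)
  open import Function using (_∘_)
  open import Defs using (eqF; zipL; colorings; colOSP; isAltColOSP; altColOSP; osp; range; perms; des)
  open Descents
  open BinomialTransform
  open FiniteSums ℕₚ.+-*-commutativeSemiring (λ e → e)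
  open BlockCounts ℕₚ.+-*-commutativeSemiring (λ e → e) using (blockSum; ∑-osp)
  open ≡-Reasoning

  length-filter : {B : Set} (f : B → Bool) (xs : List B) →
    length (filter (λ x → f x ≟B true) xs) ≡ ∑[ x ← xs ] ind (f x)
  length-filter f []       = refl
  length-filter f (x ∷ xs) with f x
  ... | true  = cong suc (length-filter f xs)
  ... | false = length-filter f xs

  ind-∧ : ∀ a b → ind (a ∧ b) ≡ ind a * ind b
  ind-∧ true  b = sym (ℕₚ.+-identityʳ (ind b))
  ind-∧ false b = refl

  ind-not : ∀ b → ind (not b) + ind b ≡ 1
  ind-not true  = refl
  ind-not false = refl

  ∑-allFin-suc : ∀ m (g : Fin (suc m) → ℕ) → ∑[ i ← allFin (suc m) ] g i ≡ g zero + ∑[ i ← allFin m ] g (suc i)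
  ∑-allFin-suc m g = cong (g zero +_) (cong sum (trans (map-tabulate suc g) (sym (map-tabulate (λ i → i) (g ∘ suc)))))

  eqF-suc : ∀ {m} (i j : Fin m) → ind (eqF (suc i) (suc j)) ≡ ind (eqF i j)
  eqF-suc i j with i ≟F j
  ... | yes _ = refl
  ... | no _  = refl

  ∑-eqF : ∀ m (d : Fin m) → ∑[ c ← allFin m ] ind (eqF c d) ≡ 1
  ∑-eqF (suc m) zero    = trans (∑-allFin-suc m (λ c → ind (eqF c zero))) (cong suc (∑-zero (allFin m)))
  ∑-eqF (suc m) (suc d) = trans (∑-allFin-suc m (λ c → ind (eqF c (suc d))))
                                (trans (∑-cong (λ c → eqF-suc c d) (allFin m)) (∑-eqF m d))

  ∑-not-eqF : ∀ c (d : Fin (suc c)) → ∑[ e ← allFin (suc c) ] ind (not (eqF e d)) ≡ c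
  ∑-not-eqF c d = ℕₚ.+-cancelʳ-≡ 1 _ c (begin
    differ + 1
      ≡⟨ cong (differ +_) (sym (∑-eqF (suc c) d)) ⟩
    differ + ∑[ e ← allFin (suc c) ] ind (eqF e d)
      ≡⟨ sym (∑-+ (λ e → ind (not (eqF e d))) (λ e → ind (eqF e d)) (allFin (suc c))) ⟩
    ∑[ e ← allFin (suc c) ] (ind (not (eqF e d)) + ind (eqF e d))
      ≡⟨ ∑-cong (λ e → ind-not (eqF e d)) (allFin (suc c)) ⟩
    ∑[ e ← allFin (suc c) ] 1
      ≡⟨ ∑-one (allFin (suc c)) ⟩
    fromℕ (length (allFin (suc c)))
      ≡⟨ fromℕ-id _ ⟩
    length (allFin (suc c))
      ≡⟨ length-tabulate (λ i → i) ⟩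
    suc c
      ≡⟨ ℕₚ.+-comm 1 c ⟩
    c + 1 ∎)
    where
    differ : ℕ
    differ = ∑[ e ← allFin (suc c) ] ind (not (eqF e d))

  length-colorings : ∀ α k → All (λ cs → length cs ≡ k) (colorings α k)
  length-colorings α zero    = refl ∷ []
  length-colorings α (suc k) =
    concat⁺ (map⁺ (All.universal (λ d → map⁺ (All.map (cong suc) (length-colorings α k))) (allFin α)))

  module AlternatingColourings (c : ℕ) (β : Fin (suc c)) where

    alternatingToβ : List (Fin (suc c)) → Bool
    alternatingToβ []          = false
    alternatingToβ (d ∷ [])    = eqF d β
    alternatingToβ (d ∷ e ∷ r) = not (eqF d e) ∧ alternatingToβ (e ∷ r)

    isAltColOSP-zip : ∀ p cs → length p ≡ length cs → isAltColOSP β (zipL p cs) ≡ alternatingToβ cs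
    isAltColOSP-zip []            []           _  = refl
    isAltColOSP-zip (_ ∷ [])      (d ∷ [])     _  = refl
    isAltColOSP-zip (_ ∷ b ∷ p)   (d ∷ e ∷ cs) eq =
      trans (∧-assoc (not (eqF d e)) _ _)
            (cong (not (eqF d e) ∧_) (isAltColOSP-zip (b ∷ p) (e ∷ cs) (ℕₚ.suc-injective eq)))
    isAltColOSP-zip []            (_ ∷ _)      ()
    isAltColOSP-zip (_ ∷ _)       []           ()
    isAltColOSP-zip (_ ∷ [])      (_ ∷ _ ∷ _)  ()
    isAltColOSP-zip (_ ∷ _ ∷ _)   (_ ∷ [])     ()

    count : ℕ → ℕ
    count k = ∑[ cs ← colorings (suc c) k ] ind (alternatingToβ cs)

    countFrom : ℕ → Fin (suc c) → ℕ
    countFrom k d = ∑[ cs ← colorings (suc c) k ] ind (alternatingToβ (d ∷ cs))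

    count-suc : ∀ k → count (suc k) ≡ ∑[ d ← allFin (suc c) ] countFrom k d
    count-suc k = trans (∑-concatMap (ind ∘ alternatingToβ) (λ d → map (d ∷_) (colorings (suc c) k)) (allFin (suc c)))
                        (∑-cong (λ d → ∑-map (ind ∘ alternatingToβ) (d ∷_) (colorings (suc c) k)) (allFin (suc c)))

    countFrom-suc : ∀ k d → countFrom (suc k) d ≡ ∑[ e ← allFin (suc c) ] (ind (not (eqF d e)) * countFrom k e)
    countFrom-suc k d =
      trans (∑-concatMap (λ cs → ind (alternatingToβ (d ∷ cs))) (λ e → map (e ∷_) (colorings (suc c) k)) (allFin (suc c)))
            (∑-cong next (allFin (suc c)))
      where
      next : ∀ e → ∑[ cs ← map (e ∷_) (colorings (suc c) k) ] ind (alternatingToβ (d ∷ cs))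
                     ≡ ind (not (eqF d e)) * countFrom k e
      next e = begin
        ∑[ cs ← map (e ∷_) (colorings (suc c) k) ] ind (alternatingToβ (d ∷ cs))
          ≡⟨ ∑-map (λ cs → ind (alternatingToβ (d ∷ cs))) (e ∷_) (colorings (suc c) k) ⟩
        ∑[ cs ← colorings (suc c) k ] ind (not (eqF d e) ∧ alternatingToβ (e ∷ cs))
          ≡⟨ ∑-cong (λ cs → ind-∧ (not (eqF d e)) (alternatingToβ (e ∷ cs))) (colorings (suc c) k) ⟩
        ∑[ cs ← colorings (suc c) k ] (ind (not (eqF d e)) * ind (alternatingToβ (e ∷ cs)))
          ≡⟨ ∑-*ˡ (ind (not (eqF d e))) (λ cs → ind (alternatingToβ (e ∷ cs))) (colorings (suc c) k) ⟩
        ind (not (eqF d e)) * countFrom k e ∎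

    ∑-countFrom : ∀ k → ∑[ d ← allFin (suc c) ] countFrom k d ≡ c ^ k
    ∑-countFrom zero    = trans (∑-cong (λ d → ℕₚ.+-identityʳ (ind (eqF d β))) (allFin (suc c))) (∑-eqF (suc c) β)
    ∑-countFrom (suc k) = begin
      ∑[ d ← colours ] countFrom (suc k) d
        ≡⟨ ∑-cong (countFrom-suc k) colours ⟩
      ∑[ d ← colours ] ∑[ e ← colours ] (ind (not (eqF d e)) * countFrom k e)
        ≡⟨ ∑-swap (λ d e → ind (not (eqF d e)) * countFrom k e) colours colours ⟩
      ∑[ e ← colours ] ∑[ d ← colours ] (ind (not (eqF d e)) * countFrom k e)
        ≡⟨ ∑-cong (λ e → ∑-*ʳ (countFrom k e) (λ d → ind (not (eqF d e))) colours) colours ⟩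
      ∑[ e ← colours ] (∑[ d ← colours ] ind (not (eqF d e)) * countFrom k e)
        ≡⟨ ∑-cong (λ e → cong (_* countFrom k e) (∑-not-eqF c e)) colours ⟩
      ∑[ e ← colours ] (c * countFrom k e)
        ≡⟨ ∑-*ˡ c (countFrom k) colours ⟩
      c * ∑[ e ← colours ] countFrom k e
        ≡⟨ cong (c *_) (∑-countFrom k) ⟩
      c * c ^ k ∎
      where
      colours : List (Fin (suc c))
      colours = allFin (suc c)

    count-pos : ∀ k → count (suc k) ≡ c ^ k
    count-pos k = trans (count-suc k) (∑-countFrom k)

    length-altColOSP : ∀ n → length (altColOSP n (suc c) β) ≡ blockSum n count
    length-altColOSP n = begin
      length (filter (λ τ → isAltColOSP β τ ≟B true) (colOSP (suc c) (range n)))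
        ≡⟨ length-filter (isAltColOSP β) (colOSP (suc c) (range n)) ⟩
      ∑[ τ ← colOSP (suc c) (range n) ] ind (isAltColOSP β τ)
        ≡⟨ ∑-concatMap (ind ∘ isAltColOSP β) (λ p → map (zipL p) (colorings (suc c) (length p))) (osp (range n)) ⟩
      ∑[ p ← osp (range n) ] ∑[ τ ← map (zipL p) (colorings (suc c) (length p)) ] ind (isAltColOSP β τ)
        ≡⟨ ∑-cong colour (osp (range n)) ⟩
      ∑[ p ← osp (range n) ] count (length p)
        ≡⟨ ∑-osp (range n) count ⟩
      blockSum (length (range n)) count
        ≡⟨ cong (λ m → blockSum m count) (length-range n) ⟩
      blockSum n count ∎
      where
      colour : ∀ p → ∑[ τ ← map (zipL p) (colorings (suc c) (length p)) ] ind (isAltColOSP β τ) ≡ count (length p)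
      colour p = trans (∑-map (ind ∘ isAltColOSP β) (zipL p) (colorings (suc c) (length p)))
                       (∑-congAll (All.map (λ |cs| → cong ind (isAltColOSP-zip p _ (sym |cs|)))
                                           (length-colorings (suc c) (length p))))

    toDescentWeight-count : ∀ m d → d ≤ m → toDescentWeight (suc m) count d ≡ c ^ (m ∸ d) * suc c ^ d
    toDescentWeight-count m d d≤m =
      trans (binomialSum-cong≤ d _ _ (λ i i≤d → trans (cong count (ℕₚ.+-∸-assoc 1 (ℕₚ.≤-trans i≤d d≤m)))
                                                         (count-pos (m ∸ i))))
            (toDescentWeight-pow c m d d≤m)

    length-altColOSP-perms : ∀ m →
      length (altColOSP (suc m) (suc c) β) ≡ ∑[ π ← perms (range (suc m)) ] (c ^ (m ∸ des π) * suc c ^ des π)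
    length-altColOSP-perms m = begin
      length (altColOSP (suc m) (suc c) β)
        ≡⟨ length-altColOSP (suc m) ⟩
      blockSum (suc m) count
        ≡⟨ blockSum≡descentSum (suc m) count ⟩
      descentSum (suc m) (toDescentWeight (suc m) count)
        ≡⟨ cong (λ l → descentSum l (toDescentWeight (suc m) count)) (sym (length-range (suc m))) ⟩
      descentSum (length (range (suc m))) (toDescentWeight (suc m) count)
        ≡⟨ sym (∑-perms (range (suc m)) (Increasing-range (suc m)) (toDescentWeight (suc m) count)) ⟩
      ∑[ π ← perms (range (suc m)) ] toDescentWeight (suc m) count (des π)
        ≡⟨ ∑-congAll (All.map (λ {π} d≤m → toDescentWeight-count m (des π) d≤m) (des-perms-range m)) ⟩
      ∑[ π ← perms (range (suc m)) ] (c ^ (m ∸ des π) * suc c ^ des π) ∎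

module RationalArithmetic where

  open import Data.Nat as ℕ using (ℕ; zero; suc; _^_)
  open import Data.Nat.Properties as ℕₚ using ()
  open import Data.Integer as ℤ using (+_)
  open import Data.Integer.Properties as ℤₚ using ()
  open import Data.Rational as ℚ using (ℚ; _/_; 1ℚ)
  open import Data.Rational.Properties as ℚₚ using ()
  import Data.Rational.Solver as ℚSolver
  open import Data.Rational.Unnormalised as ℚᵘ using (ℚᵘ; mkℚᵘ; *≡*)
  open import Data.Rational.Unnormalised.Properties as ℚᵘₚ using ()
  open import Algebra.Bundles using (CommutativeRing)
  open import Data.List using (List; []; _∷_)
  open import Function using (_∘_)
  open import Relation.Binary.PropositionalEquality using (_≡_; refl; sym; trans; cong; cong₂; module ≡-Reasoning)
  open import Defs using (powℚ)
  open FiniteSums ℕₚ.+-*-commutativeSemiring (λ e → e) using () renaming (∑ to ∑ℕ)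
  open FiniteSums (CommutativeRing.commutativeSemiring ℚₚ.+-*-commutativeRing) (λ e → e) using (∑)

  back : ∀ p → p ℚᵘ.≃ ℚ.toℚᵘ (ℚ.fromℚᵘ p)
  back p = ℚᵘₚ.≃-sym (ℚₚ.toℚᵘ-fromℚᵘ p)

  fromℚᵘ-homo-+ : ∀ p q → ℚ.fromℚᵘ (p ℚᵘ.+ q) ≡ ℚ.fromℚᵘ p ℚ.+ ℚ.fromℚᵘ q
  fromℚᵘ-homo-+ p q = ℚₚ.toℚᵘ-injective (begin
    ℚ.toℚᵘ (ℚ.fromℚᵘ (p ℚᵘ.+ q))                 ≈⟨ ℚₚ.toℚᵘ-fromℚᵘ (p ℚᵘ.+ q) ⟩
    p ℚᵘ.+ q                                       ≈⟨ ℚᵘₚ.+-cong (back p) (back q) ⟩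
    ℚ.toℚᵘ (ℚ.fromℚᵘ p) ℚᵘ.+ ℚ.toℚᵘ (ℚ.fromℚᵘ q)  ≈⟨ ℚᵘₚ.≃-sym (ℚₚ.toℚᵘ-homo-+ (ℚ.fromℚᵘ p) (ℚ.fromℚᵘ q)) ⟩
    ℚ.toℚᵘ (ℚ.fromℚᵘ p ℚ.+ ℚ.fromℚᵘ q)            ∎)
    where open ℚᵘₚ.≃-Reasoning

  fromℚᵘ-homo-* : ∀ p q → ℚ.fromℚᵘ (p ℚᵘ.* q) ≡ ℚ.fromℚᵘ p ℚ.* ℚ.fromℚᵘ q
  fromℚᵘ-homo-* p q = ℚₚ.toℚᵘ-injective (begin
    ℚ.toℚᵘ (ℚ.fromℚᵘ (p ℚᵘ.* q))                 ≈⟨ ℚₚ.toℚᵘ-fromℚᵘ (p ℚᵘ.* q) ⟩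
    p ℚᵘ.* q                                       ≈⟨ ℚᵘₚ.*-cong (back p) (back q) ⟩
    ℚ.toℚᵘ (ℚ.fromℚᵘ p) ℚᵘ.* ℚ.toℚᵘ (ℚ.fromℚᵘ q)  ≈⟨ ℚᵘₚ.≃-sym (ℚₚ.toℚᵘ-homo-* (ℚ.fromℚᵘ p) (ℚ.fromℚᵘ q)) ⟩
    ℚ.toℚᵘ (ℚ.fromℚᵘ p ℚ.* ℚ.fromℚᵘ q)            ∎)
    where open ℚᵘₚ.≃-Reasoning

  ℕ→ℚ : ℕ → ℚ
  ℕ→ℚ n = + n / 1

  ℕ→ℚ-+ : ∀ m n → ℕ→ℚ (m ℕ.+ n) ≡ ℕ→ℚ m ℚ.+ ℕ→ℚ n
  ℕ→ℚ-+ m n = trans (ℚₚ.fromℚᵘ-cong {mkℚᵘ (+ (m ℕ.+ n)) 0} {m/1 ℚᵘ.+ n/1} (*≡* same)) (fromℚᵘ-homo-+ m/1 n/1)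
    where
    m/1 n/1 : ℚᵘ
    m/1 = mkℚᵘ (+ m) 0
    n/1 = mkℚᵘ (+ n) 0
    same : + (m ℕ.+ n) ℤ.* + 1 ≡ (+ m ℤ.* + 1 ℤ.+ + n ℤ.* + 1) ℤ.* + 1
    same = cong (ℤ._* + 1) (trans (ℤₚ.pos-+ m n)
                                  (sym (cong₂ ℤ._+_ (ℤₚ.*-identityʳ (+ m)) (ℤₚ.*-identityʳ (+ n)))))

  ℕ→ℚ-* : ∀ m n → ℕ→ℚ (m ℕ.* n) ≡ ℕ→ℚ m ℚ.* ℕ→ℚ n
  ℕ→ℚ-* m n = trans (cong (λ k → k / 1) (ℤₚ.pos-* m n)) (fromℚᵘ-homo-* (mkℚᵘ (+ m) 0) (mkℚᵘ (+ n) 0))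

  ℕ→ℚ-^ : ∀ m k → ℕ→ℚ (m ^ k) ≡ powℚ (ℕ→ℚ m) k
  ℕ→ℚ-^ m zero    = refl
  ℕ→ℚ-^ m (suc k) = trans (ℕ→ℚ-* m (m ^ k)) (cong (ℕ→ℚ m ℚ.*_) (ℕ→ℚ-^ m k))

  ℕ→ℚ-∑ : {B : Set} (xs : List B) (f : B → ℕ) → ℕ→ℚ (∑ℕ xs f) ≡ ∑ xs (ℕ→ℚ ∘ f)
  ℕ→ℚ-∑ []       f = refl
  ℕ→ℚ-∑ (x ∷ xs) f = trans (ℕ→ℚ-+ (f x) (∑ℕ xs f)) (cong (ℕ→ℚ (f x) ℚ.+_) (ℕ→ℚ-∑ xs f))

  fraction-product : ∀ x y z u v → x ℕ.* y ≡ z ℕ.* (suc u ℕ.* suc v) → (+ x / suc u) ℚ.* (+ y / suc v) ≡ ℕ→ℚ z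
  fraction-product x y z u v xy≡z·uv =
    trans (sym (fromℚᵘ-homo-* (mkℚᵘ (+ x) u) (mkℚᵘ (+ y) v)))
          (ℚₚ.fromℚᵘ-cong {mkℚᵘ (+ x) u ℚᵘ.* mkℚᵘ (+ y) v} {mkℚᵘ (+ z) 0} (*≡* cross))
    where
    cross : (+ x ℤ.* + y) ℤ.* + 1 ≡ + z ℤ.* + (suc u ℕ.* suc v)
    cross = begin
      (+ x ℤ.* + y) ℤ.* + 1      ≡⟨ ℤₚ.*-identityʳ (+ x ℤ.* + y) ⟩
      + x ℤ.* + y                 ≡⟨ sym (ℤₚ.pos-* x y) ⟩
      + (x ℕ.* y)                 ≡⟨ cong +_ xy≡z·uv ⟩
      + (z ℕ.* (suc u ℕ.* suc v)) ≡⟨ ℤₚ.pos-* z (suc u ℕ.* suc v) ⟩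
      + z ℤ.* + (suc u ℕ.* suc v) ∎
      where open ≡-Reasoning

  powℚ-* : ∀ x y k → powℚ (x ℚ.* y) k ≡ powℚ x k ℚ.* powℚ y k
  powℚ-* x y zero    = sym (ℚₚ.*-identityˡ 1ℚ)
  powℚ-* x y (suc k) = trans (cong ((x ℚ.* y) ℚ.*_) (powℚ-* x y k))
    (solve 4 (λ x y u v → (x :* y) :* (u :* v) := (x :* u) :* (y :* v)) refl x y (powℚ x k) (powℚ y k))
    where open ℚSolver.+-*-Solver

open import Defs
open import Data.Nat using (ℕ; suc; _+_; _^_; _∸_; _≤_)
open import Data.Nat.Solver using (module +-*-Solver)
open import Data.Fin using (Fin)
open import Data.Integer using (+_)
open import Data.Rational using (ℚ; _/_; _*_)
open import Data.Rational.Properties as ℚₚ using ()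
open import Algebra.Bundles using (CommutativeRing)
import Data.List.Relation.Unary.All as All
open Descents using (des-perms-range)
open EulerCharacteristic using (eulerChar≡count)
open Colourings using (module AlternatingColourings)
open RationalArithmetic using (ℕ→ℚ; ℕ→ℚ-*; ℕ→ℚ-^; ℕ→ℚ-∑; fraction-product; powℚ-*)

eulerianTerm : ∀ a m d → d ≤ m →
  ((+ (suc a ^ suc m)) / (2 + a)) * powℚ ((+ (2 + a)) / suc a) (suc d) ≡ ℕ→ℚ (suc a ^ (m ∸ d) ℕ.* (2 + a) ^ d)
eulerianTerm a m d d≤m = begin
  s * (q * powℚ q d)                       ≡⟨ sym (ℚₚ.*-assoc s q (powℚ q d)) ⟩
  (s * q) * powℚ q d                       ≡⟨ cong (_* powℚ q d) s·q ⟩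
  ℕ→ℚ (c ^ m) * powℚ q d                   ≡⟨ cong (λ k → ℕ→ℚ (c ^ k) * powℚ q d) (sym (ℕₚ.m∸n+n≡m d≤m)) ⟩
  ℕ→ℚ (c ^ (e + d)) * powℚ q d             ≡⟨ cong (_* powℚ q d) (trans (cong ℕ→ℚ (ℕₚ.^-distribˡ-+-* c e d))
                                                                        (ℕ→ℚ-* (c ^ e) (c ^ d))) ⟩
  (ℕ→ℚ (c ^ e) * ℕ→ℚ (c ^ d)) * powℚ q d  ≡⟨ ℚₚ.*-assoc (ℕ→ℚ (c ^ e)) (ℕ→ℚ (c ^ d)) (powℚ q d) ⟩
  ℕ→ℚ (c ^ e) * (ℕ→ℚ (c ^ d) * powℚ q d)  ≡⟨ cong (λ x → ℕ→ℚ (c ^ e) * (x * powℚ q d)) (ℕ→ℚ-^ c d) ⟩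
  ℕ→ℚ (c ^ e) * (powℚ (ℕ→ℚ c) d * powℚ q d) ≡⟨ cong (ℕ→ℚ (c ^ e) *_) (sym (powℚ-* (ℕ→ℚ c) q d)) ⟩
  ℕ→ℚ (c ^ e) * powℚ (ℕ→ℚ c * q) d        ≡⟨ cong (λ x → ℕ→ℚ (c ^ e) * powℚ x d) c·q ⟩
  ℕ→ℚ (c ^ e) * powℚ (ℕ→ℚ α) d            ≡⟨ cong (ℕ→ℚ (c ^ e) *_) (sym (ℕ→ℚ-^ α d)) ⟩
  ℕ→ℚ (c ^ e) * ℕ→ℚ (α ^ d)               ≡⟨ sym (ℕ→ℚ-* (c ^ e) (α ^ d)) ⟩
  ℕ→ℚ (c ^ e ℕ.* α ^ d)                   ∎
  where
  open ≡-Reasoning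
  open +-*-Solver using (solve; _:+_; _:*_; _:=_; con)
  c α e : ℕ
  c = suc a
  α = 2 + a
  e = m ∸ d
  s q : ℚ
  s = (+ (c ^ suc m)) / α
  q = (+ α) / c
  s·q : s * q ≡ ℕ→ℚ (c ^ m)
  s·q = fraction-product (c ^ suc m) α (c ^ m) (suc a) a
          (solve 2 (λ a p → ((con 1 :+ a) :* p) :* (con 2 :+ a) := p :* ((con 2 :+ a) :* (con 1 :+ a))) refl a (c ^ m))
  c·q : ℕ→ℚ c * q ≡ ℕ→ℚ α
  c·q = fraction-product c α α 0 a
          (solve 1 (λ a → (con 1 :+ a) :* (con 2 :+ a) := (con 2 :+ a) :* (con 1 :* (con 1 :+ a))) refl a)

proposition4p6 : (n : ℕ) → 1 Data.Nat.≤ n → (a : ℕ) → (β : Fin (2 + a)) →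
    (eulerChar n (2 + a) β / 1) ≡ ((+ (suc a ^ n)) / (2 + a)) * eulerianA n ((+ (2 + a)) / suc a)
proposition4p6 zero    ()  a β
proposition4p6 (suc m) _   a β = begin
  eulerChar (suc m) α β / 1
    ≡⟨ cong (λ z → z / 1) (eulerChar≡count (suc m) α β) ⟩
  ℕ→ℚ (length (altColOSP (suc m) α β))
    ≡⟨ cong ℕ→ℚ (length-altColOSP-perms m) ⟩
  ℕ→ℚ (∑ℕ perms[m+1] (λ π → suc a ^ (m ∸ des π) ℕ.* α ^ des π))
    ≡⟨ ℕ→ℚ-∑ perms[m+1] (λ π → suc a ^ (m ∸ des π) ℕ.* α ^ des π) ⟩
  ∑ perms[m+1] (λ π → ℕ→ℚ (suc a ^ (m ∸ des π) ℕ.* α ^ des π))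
    ≡⟨ sym (∑-congAll (All.map (eulerianTerm a m _) (des-perms-range m))) ⟩
  ∑ perms[m+1] (λ π → s * powℚ q (suc (des π)))
    ≡⟨ ∑-*ˡ s (λ π → powℚ q (suc (des π))) perms[m+1] ⟩
  s * eulerianA (suc m) q ∎
  where
  open ≡-Reasoning
  open AlternatingColourings (suc a) β using (length-altColOSP-perms)
  open FiniteSums ℕₚ.+-*-commutativeSemiring (λ e → e) using () renaming (∑ to ∑ℕ)
  open FiniteSums (CommutativeRing.commutativeSemiring ℚₚ.+-*-commutativeRing) (λ e → e) using (∑; ∑-congAll; ∑-*ˡ)
  α : ℕ
  α = 2 + a
  s q : ℚ
  s = (+ (suc a ^ suc m)) / α
  q = (+ α) / suc a
  perms[m+1] : List (List ℕ)
  perms[m+1] = perms (range (suc m))
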